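{- Let $f(t),g(t)\in\mathbb{Q}[t]$ be polynomials such that $(x,y,z)=(f(t),t,g(t))$ satisfies $$xy(x^2+y^2-1)=z^3,$$ i.e. $f(t)\,t\,(f(t)^2+t^2-1)=g(t)^3$. Then $(f(t),g(t))=(1,t)$ or $(f(t),g(t))=(-1,-t)$. -}

module Defs where

open import Data.Nat using (ℕ; zero; suc)
open import Data.List using (List; []; _∷_)
open import Data.Rational using (ℚ; 0ℚ; 1ℚ; -_) renaming (_+_ to _+ℚ_; _*_ to _*ℚ_)
open import Relation.Binary.PropositionalEquality using (_≡_)

-- Univariate polynomials over ℚ, as coefficient lists (constant term first).
-- Trailing zeros are allowed; equality of polynomials is coefficientwise (_≈P_).
Poly : Set
Poly = List ℚ

coeff : Poly → ℕ → ℚ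
coeff []       _       = 0ℚ
coeff (a ∷ p)  zero    = a
coeff (a ∷ p)  (suc n) = coeff p n

_≈P_ : Poly → Poly → Set
p ≈P q = ∀ n → coeff p n ≡ coeff q n

infix 4 _≈P_
infixl 6 _+P_
infixl 7 _*P_

constP : ℚ → Poly
constP a = a ∷ []

tP : Poly
tP = 0ℚ ∷ 1ℚ ∷ []

_+P_ : Poly → Poly → Poly
[]      +P q       = q
(a ∷ p) +P []      = a ∷ p
(a ∷ p) +P (b ∷ q) = (a +ℚ b) ∷ (p +P q)

scaleP : ℚ → Poly → Poly
scaleP a []      = []
scaleP a (b ∷ p) = (a *ℚ b) ∷ scaleP a p

negP : Poly → Poly
negP = scaleP (- 1ℚ)

_*P_ : Poly → Poly → Poly
[]      *P q = []
(a ∷ p) *P q = scaleP a q +P (0ℚ ∷ (p *P q))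

{-# OPTIONS --safe #-}
-- Compare degrees. If f has degree d ≥ 1 and leading coefficient a, then f² + t² − 1 has degree 2d
-- (leading coefficient a² or a² + 1, never 0), so the left-hand side has degree 3d + 1, which is not
-- divisible by 3, unlike deg g³. So f is a nonzero constant a (f = 0 would force g = 0), the left-hand
-- side a(a² − 1)t + at³ has degree 3 and leading coefficient a, and g = c + bt with b³ = a. The
-- coefficient of t⁰ gives c³ = 0, that of t gives a(a² − 1) = 3c²b = 0; hence a = ±1 and b = a.
module Submission where

open import Defs
open import Data.Empty using (⊥-elim)
open import Data.Integer using (+_)
open import Data.List using ([]; _∷_)
open import Data.Nat as ℕ using (ℕ; zero; suc; _<_; _≤_; s≤s; z<s)
import Data.Nat.Properties as ℕ
open import Data.Nat.DivMod using (_%_; m*n%n≡0; [m+kn]%n≡m%n)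
open import Data.Nat.Tactic.RingSolver using (solve-∀)
open import Data.Product using (_×_; _,_; proj₁; ∃-syntax)
open import Data.Rational
  using (ℚ; 0ℚ; 1ℚ; ½; -_; _+_; _*_; _-_; _/_; Positive; NonNegative; nonNegative; nonPositive)
open import Data.Rational.Properties
open import Data.Rational.Solver using (module +-*-Solver)
open import Data.Sum using (_⊎_; inj₁; inj₂; [_,_]′; map; map₁; reduce; fromInj₂)
open import Function using (_∘_)
open import Relation.Binary.Definitions using (tri<; tri≈; tri>)
open import Relation.Binary.PropositionalEquality
open import Relation.Nullary using (¬_; yes; no; contradiction)
open import Algebra.Apartness.Properties.HeytingCommutativeRing heytingCommutativeRing
  using (x#0y#0→xy#0)
open import Algebra.Properties.Group +-0-group using (x∙y⁻¹≈ε⇒x≈y)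

open ≡-Reasoning

private variable
  x y a b : ℚ
  m n : ℕ
  p q f g : Poly

x*y≡0⇒x≡0∨y≡0 : x * y ≡ 0ℚ → x ≡ 0ℚ ⊎ y ≡ 0ℚ
x*y≡0⇒x≡0∨y≡0 {x} {y} xy≡0 with x ≟ 0ℚ | y ≟ 0ℚ
... | yes x≡0 | _       = inj₁ x≡0
... | no _    | yes y≡0 = inj₂ y≡0
... | no x≢0  | no y≢0  = contradiction xy≡0 (x#0y#0→xy#0 x≢0 y≢0)

x*x*x≡0⇒x≡0 : x * x * x ≡ 0ℚ → x ≡ 0ℚ
x*x*x≡0⇒x≡0 = reduce ∘ map₁ (reduce ∘ x*y≡0⇒x≡0∨y≡0) ∘ x*y≡0⇒x≡0∨y≡0

x*x-nonNeg : ∀ x → NonNegative (x * x)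
x*x-nonNeg x with ≤-total 0ℚ x
... | inj₁ 0≤x = nonNeg*nonNeg⇒nonNeg x {{nonNegative 0≤x}} x {{nonNegative 0≤x}}
... | inj₂ x≤0 = nonPos*nonPos⇒nonPos x {{nonPositive x≤0}} x {{nonPositive x≤0}}

x*x+y≢0 : ∀ x y .{{_ : Positive y}} → x * x + y ≢ 0ℚ
x*x+y≢0 x y eq = <⇒≢ (positive⁻¹ (x * x + y) {{nonNeg+pos⇒pos (x * x) {{x*x-nonNeg x}} y}}) (sym eq)

module _ where
  open +-*-Solver

  difference-of-squares : ∀ x → (x - 1ℚ) * (x + 1ℚ) ≡ x * x - 1ℚ
  difference-of-squares = solve 1 (λ x → (x :- con 1ℚ) :* (x :+ con 1ℚ) := x :* x :- con 1ℚ) refl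

  difference-of-cubes : ∀ x → (x - 1ℚ) * (x * x + x + 1ℚ) ≡ x * x * x - 1ℚ
  difference-of-cubes = solve 1 (λ x → (x :- con 1ℚ) :* (x :* x :+ x :+ con 1ℚ) := x :* x :* x :- con 1ℚ) refl

  completing-square : ∀ x → x * x + x + 1ℚ ≡ (x + ½) * (x + ½) + (+ 3 / 4)
  completing-square = solve 1 (λ x → x :* x :+ x :+ con 1ℚ := (x :+ con ½) :* (x :+ con ½) :+ con (+ 3 / 4)) refl

  cube-neg : ∀ x → (- x) * (- x) * (- x) ≡ - (x * x * x)
  cube-neg = solve 1 (λ x → (:- x) :* (:- x) :* (:- x) := :- (x :* x :* x)) refl

x*x-1≡0⇒x≡1∨x≡-1 : x * x - 1ℚ ≡ 0ℚ → x ≡ 1ℚ ⊎ x ≡ - 1ℚ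
x*x-1≡0⇒x≡1∨x≡-1 {x} eq =
  map (x∙y⁻¹≈ε⇒x≈y x 1ℚ) (x∙y⁻¹≈ε⇒x≈y x (- 1ℚ))
      (x*y≡0⇒x≡0∨y≡0 (trans (difference-of-squares x) eq))

x*x*x≡1⇒x≡1 : x * x * x ≡ 1ℚ → x ≡ 1ℚ
x*x*x≡1⇒x≡1 {x} eq =
  [ x∙y⁻¹≈ε⇒x≈y x 1ℚ , ⊥-elim ∘ x*x+x+1≢0 ]′
    (x*y≡0⇒x≡0∨y≡0 (trans (difference-of-cubes x) (cong (_- 1ℚ) eq)))
  where
  x*x+x+1≢0 : x * x + x + 1ℚ ≢ 0ℚ
  x*x+x+1≢0 = x*x+y≢0 (x + ½) (+ 3 / 4) ∘ trans (sym (completing-square x))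

x*x*x≡-1⇒x≡-1 : x * x * x ≡ - 1ℚ → x ≡ - 1ℚ
x*x*x≡-1⇒x≡-1 {x} eq = neg-injective (x*x*x≡1⇒x≡1 (trans (cube-neg x) (cong -_ eq)))

x*x*x≡±1⇒x≡±1 : y ≡ 1ℚ ⊎ y ≡ - 1ℚ → x * x * x ≡ y → x ≡ y
x*x*x≡±1⇒x≡±1 (inj₁ refl) = x*x*x≡1⇒x≡1
x*x*x≡±1⇒x≡±1 (inj₂ refl) = x*x*x≡-1⇒x≡-1

coeff-+P : ∀ p q n → coeff (p +P q) n ≡ coeff p n + coeff q n
coeff-+P []      q       n       = sym (+-identityˡ (coeff q n))
coeff-+P (a ∷ p) []      n       = sym (+-identityʳ (coeff (a ∷ p) n))
coeff-+P (a ∷ p) (b ∷ q) zero    = refl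
coeff-+P (a ∷ p) (b ∷ q) (suc n) = coeff-+P p q n

coeff-scaleP : ∀ a p n → coeff (scaleP a p) n ≡ a * coeff p n
coeff-scaleP a []      n       = sym (*-zeroʳ a)
coeff-scaleP a (b ∷ p) zero    = refl
coeff-scaleP a (b ∷ p) (suc n) = coeff-scaleP a p n

coeff-∷*P : ∀ a p q n → coeff ((a ∷ p) *P q) n ≡ a * coeff q n + coeff (0ℚ ∷ p *P q) n
coeff-∷*P a p q n =
  trans (coeff-+P (scaleP a q) (0ℚ ∷ p *P q) n) (cong (_+ coeff (0ℚ ∷ p *P q) n) (coeff-scaleP a q n))

coeff₀-*P : ∀ p q → coeff (p *P q) 0 ≡ coeff p 0 * coeff q 0
coeff₀-*P []      q = sym (*-zeroˡ (coeff q 0))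
coeff₀-*P (a ∷ p) q = trans (coeff-∷*P a p q 0) (+-identityʳ (a * coeff q 0))

coeff₁-*P : ∀ p q → coeff (p *P q) 1 ≡ coeff p 0 * coeff q 1 + coeff p 1 * coeff q 0
coeff₁-*P []      q = sym (cong₂ _+_ (*-zeroˡ (coeff q 1)) (*-zeroˡ (coeff q 0)))
coeff₁-*P (a ∷ p) q = trans (coeff-∷*P a p q 1) (cong (λ r → a * coeff q 1 + r) (coeff₀-*P p q))

0∷-≈P[] : ∀ p → p ≈P [] → 0ℚ ∷ p ≈P []
0∷-≈P[] p p≈0 zero    = refl
0∷-≈P[] p p≈0 (suc n) = p≈0 n

a*0+0≡0 : ∀ a → a * 0ℚ + 0ℚ ≡ 0ℚ
a*0+0≡0 a = trans (+-identityʳ (a * 0ℚ)) (*-zeroʳ a)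

*P-zeroˡ : ∀ p q → p ≈P [] → p *P q ≈P []
*P-zeroˡ []      q p≈0 n = refl
*P-zeroˡ (a ∷ p) q p≈0 n = begin
  coeff ((a ∷ p) *P q) n                ≡⟨ coeff-∷*P a p q n ⟩
  a * coeff q n + coeff (0ℚ ∷ p *P q) n ≡⟨ cong₂ (λ c d → c * coeff q n + d) (p≈0 0) (0∷-≈P[] _ (*P-zeroˡ p q (p≈0 ∘ suc)) n) ⟩
  0ℚ * coeff q n + 0ℚ                   ≡⟨ trans (+-identityʳ _) (*-zeroˡ (coeff q n)) ⟩
  0ℚ                                    ∎

*P-tP : ∀ p → p *P tP ≈P 0ℚ ∷ p
*P-tP []      zero    = refl
*P-tP []      (suc n) = refl
*P-tP (a ∷ p) n       = trans (coeff-∷*P a p tP n) (shift n)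
  where
  shift : ∀ n → a * coeff tP n + coeff (0ℚ ∷ p *P tP) n ≡ coeff (0ℚ ∷ a ∷ p) n
  shift zero          = a*0+0≡0 a
  shift (suc zero)    = trans (cong₂ _+_ (*-identityʳ a) (*P-tP p 0)) (+-identityʳ a)
  shift (suc (suc n)) = trans (cong₂ _+_ (*-zeroʳ a) (*P-tP p (suc n))) (+-identityˡ (coeff p n))

-- Lists may carry trailing zeros, so degrees are read off the coefficients.
record Degree≤ (p : Poly) (n : ℕ) : Set where
  constructor degree≤
  field vanishes : ∀ j → n < j → coeff p j ≡ 0ℚ
open Degree≤

record Leading (p : Poly) (n : ℕ) (a : ℚ) : Set where
  field
    coeff≡   : coeff p n ≡ a
    nonzero  : a ≢ 0ℚ
    bounded  : Degree≤ p n
open Leading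

Degree≤-mono : m ≤ n → Degree≤ p m → Degree≤ p n
Degree≤-mono m≤n p≤m = degree≤ λ j n<j → vanishes p≤m j (ℕ.≤-<-trans m≤n n<j)

Degree≤-tail : Degree≤ (a ∷ p) (suc n) → Degree≤ p n
Degree≤-tail a∷p≤1+n = degree≤ λ j n<j → vanishes a∷p≤1+n (suc j) (s≤s n<j)

Degree≤0⇒tail≈P[] : Degree≤ (a ∷ p) 0 → p ≈P []
Degree≤0⇒tail≈P[] a∷p≤0 j = vanishes a∷p≤0 (suc j) z<s

Degree≤-+P : Degree≤ p n → Degree≤ q n → Degree≤ (p +P q) n
Degree≤-+P {p} {q = q} p≤n q≤n =
  degree≤ λ j n<j → trans (coeff-+P p q j) (cong₂ _+_ (vanishes p≤n j n<j) (vanishes q≤n j n<j))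

Degree≤-*P : Degree≤ p m → Degree≤ q n → Degree≤ (p *P q) (m ℕ.+ n)
Degree≤-*P {[]}    p≤m q≤n = degree≤ λ _ _ → refl
Degree≤-*P {a ∷ p} {zero} {q} p≤0 q≤n = degree≤ λ j n<j → begin
  coeff ((a ∷ p) *P q) j                 ≡⟨ coeff-∷*P a p q j ⟩
  a * coeff q j + coeff (0ℚ ∷ p *P q) j  ≡⟨ cong₂ (λ c d → a * c + d) (vanishes q≤n j n<j) (0∷-≈P[] _ (*P-zeroˡ p q (Degree≤0⇒tail≈P[] p≤0)) j) ⟩
  a * 0ℚ + 0ℚ                            ≡⟨ a*0+0≡0 a ⟩
  0ℚ                                     ∎
Degree≤-*P {a ∷ p} {suc m} {q} {n} p≤m q≤n = degree≤ vanish
  where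
  vanish : ∀ j → suc (m ℕ.+ n) < j → coeff ((a ∷ p) *P q) j ≡ 0ℚ
  vanish (suc j) (s≤s m+n<j) = begin
    coeff ((a ∷ p) *P q) (suc j)           ≡⟨ coeff-∷*P a p q (suc j) ⟩
    a * coeff q (suc j) + coeff (p *P q) j ≡⟨ cong₂ (λ c d → a * c + d) (vanishes q≤n (suc j) n<1+j) (vanishes (Degree≤-*P (Degree≤-tail p≤m) q≤n) j m+n<j) ⟩
    a * 0ℚ + 0ℚ                            ≡⟨ a*0+0≡0 a ⟩
    0ℚ                                     ∎
    where
    n<1+j : n < suc j
    n<1+j = s≤s (ℕ.≤-trans (ℕ.m≤n+m n m) (ℕ.<⇒≤ m+n<j))

coeff-*P-top : Degree≤ p m → Degree≤ q n → coeff (p *P q) (m ℕ.+ n) ≡ coeff p m * coeff q n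
coeff-*P-top {[]} {m} {q} {n} _ _ = sym (*-zeroˡ (coeff q n))
coeff-*P-top {a ∷ p} {zero} {q} {n} p≤0 q≤n = begin
  coeff ((a ∷ p) *P q) n                 ≡⟨ coeff-∷*P a p q n ⟩
  a * coeff q n + coeff (0ℚ ∷ p *P q) n  ≡⟨ cong (λ r → a * coeff q n + r) (0∷-≈P[] _ (*P-zeroˡ p q (Degree≤0⇒tail≈P[] p≤0)) n) ⟩
  a * coeff q n + 0ℚ                     ≡⟨ +-identityʳ (a * coeff q n) ⟩
  a * coeff q n                          ∎
coeff-*P-top {a ∷ p} {suc m} {q} {n} p≤m q≤n = begin
  coeff ((a ∷ p) *P q) (suc (m ℕ.+ n))                   ≡⟨ coeff-∷*P a p q (suc (m ℕ.+ n)) ⟩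
  a * coeff q (suc (m ℕ.+ n)) + coeff (p *P q) (m ℕ.+ n) ≡⟨ cong₂ (λ c d → a * c + d) (vanishes q≤n _ (s≤s (ℕ.m≤n+m n m))) (coeff-*P-top (Degree≤-tail p≤m) q≤n) ⟩
  a * 0ℚ + coeff p m * coeff q n                         ≡⟨ cong (_+ coeff p m * coeff q n) (*-zeroʳ a) ⟩
  0ℚ + coeff p m * coeff q n                             ≡⟨ +-identityˡ (coeff p m * coeff q n) ⟩
  coeff p m * coeff q n                                  ∎

Leading-resp-≈P : p ≈P q → Leading p n a → Leading q n a
Leading-resp-≈P {n = n} p≈q lp = record
  { coeff≡  = trans (sym (p≈q n)) (coeff≡ lp)
  ; nonzero = nonzero lp
  ; bounded = degree≤ λ j n<j → trans (sym (p≈q j)) (vanishes (bounded lp) j n<j)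
  }

Leading-unique : Leading p m a → Leading p n b → m ≡ n × a ≡ b
Leading-unique {m = m} {n = n} lp lp′ with ℕ.<-cmp m n
... | tri< m<n _ _ = contradiction (trans (sym (coeff≡ lp′)) (vanishes (bounded lp) n m<n)) (nonzero lp′)
... | tri≈ _ refl _ = refl , trans (sym (coeff≡ lp)) (coeff≡ lp′)
... | tri> _ _ n<m = contradiction (trans (sym (coeff≡ lp)) (vanishes (bounded lp′) m n<m)) (nonzero lp)

Leading⇒≉P[] : Leading p n a → ¬ p ≈P []
Leading⇒≉P[] {n = n} lp p≈0 = nonzero lp (trans (sym (coeff≡ lp)) (p≈0 n))

leading? : ∀ p → p ≈P [] ⊎ ∃[ n ] ∃[ a ] Leading p n a
leading? [] = inj₁ λ _ → refl
leading? (a ∷ p) with leading? p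
... | inj₂ (n , b , lp) = inj₂ (suc n , b , record
  { coeff≡  = coeff≡ lp
  ; nonzero = nonzero lp
  ; bounded = degree≤ λ { (suc j) (s≤s n<j) → vanishes (bounded lp) j n<j }
  })
... | inj₁ p≈0 with a ≟ 0ℚ
...   | yes a≡0 = inj₁ λ { zero → a≡0 ; (suc j) → p≈0 j }
...   | no a≢0  = inj₂ (0 , a , record
  { coeff≡  = refl
  ; nonzero = a≢0
  ; bounded = degree≤ λ { (suc j) _ → p≈0 j }
  })

Leading-*P : Leading p m a → Leading q n b → Leading (p *P q) (m ℕ.+ n) (a * b)
Leading-*P lp lq = record
  { coeff≡  = trans (coeff-*P-top (bounded lp) (bounded lq)) (cong₂ _*_ (coeff≡ lp) (coeff≡ lq))
  ; nonzero = x#0y#0→xy#0 (nonzero lp) (nonzero lq)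
  ; bounded = Degree≤-*P (bounded lp) (bounded lq)
  }

Leading-+P-same : Leading p n a → Leading q n b → a + b ≢ 0ℚ → Leading (p +P q) n (a + b)
Leading-+P-same {p} {n} {q = q} lp lq a+b≢0 = record
  { coeff≡  = trans (coeff-+P p q n) (cong₂ _+_ (coeff≡ lp) (coeff≡ lq))
  ; nonzero = a+b≢0
  ; bounded = Degree≤-+P (bounded lp) (bounded lq)
  }

Leading-+P-lowerʳ : Leading p n a → Degree≤ q m → m < n → Leading (p +P q) n a
Leading-+P-lowerʳ {p} {n} {a} {q} lp q≤m m<n = record
  { coeff≡  = trans (coeff-+P p q n) (trans (cong₂ _+_ (coeff≡ lp) (vanishes q≤m n m<n)) (+-identityʳ a))
  ; nonzero = nonzero lp
  ; bounded = Degree≤-+P (bounded lp) (Degree≤-mono (ℕ.<⇒≤ m<n) q≤m)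
  }

Leading-+P-lowerˡ : Degree≤ p m → m < n → Leading q n b → Leading (p +P q) n b
Leading-+P-lowerˡ {p} {m} {n} {q} {b} p≤m m<n lq = record
  { coeff≡  = trans (coeff-+P p q n) (trans (cong₂ _+_ (vanishes p≤m n m<n) (coeff≡ lq)) (+-identityˡ b))
  ; nonzero = nonzero lq
  ; bounded = Degree≤-+P (Degree≤-mono (ℕ.<⇒≤ m<n) p≤m) (bounded lq)
  }

circle : Poly → Poly
circle f = f *P f +P tP *P tP +P negP (constP 1ℚ)

xyCircle : Poly → Poly
xyCircle f = f *P tP *P circle f

cube : Poly → Poly
cube g = g *P g *P g

Leading-tP : Leading tP 1 1ℚ
Leading-tP = record
  { coeff≡  = refl
  ; nonzero = λ ()
  ; bounded = degree≤ λ { (suc (suc j)) _ → refl ; (suc zero) (s≤s ()) }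
  }

Leading-tP*tP : Leading (tP *P tP) 2 1ℚ
Leading-tP*tP = Leading-*P Leading-tP Leading-tP

Degree≤-constP : Degree≤ (constP a) 0
Degree≤-constP = degree≤ λ { (suc j) _ → refl }

Leading-cube : Leading g m b → Leading (cube g) (m ℕ.* 3) (b * b * b)
Leading-cube {g = g} {m = m} {b = b} lg =
  subst (λ d → Leading (cube g) d (b * b * b)) (m+m+m≡m*3 m) (Leading-*P (Leading-*P lg lg) lg)
  where
  m+m+m≡m*3 : ∀ m → m ℕ.+ m ℕ.+ m ≡ m ℕ.* 3
  m+m+m≡m*3 = solve-∀

Leading-circle-const : Leading f 0 a → Leading (circle f) 2 1ℚ
Leading-circle-const lf =
  Leading-+P-lowerʳ (Leading-+P-lowerˡ (bounded (Leading-*P lf lf)) z<s Leading-tP*tP) Degree≤-constP z<s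

Leading-circle-linear : Leading f 1 a → Leading (circle f) 2 (a * a + 1ℚ)
Leading-circle-linear {a = a} lf =
  Leading-+P-lowerʳ (Leading-+P-same (Leading-*P lf lf) Leading-tP*tP (x*x+y≢0 a 1ℚ)) Degree≤-constP z<s

Leading-circle-≥2 : Leading f (2 ℕ.+ n) a → Leading (circle f) ((2 ℕ.+ n) ℕ.+ (2 ℕ.+ n)) (a * a)
Leading-circle-≥2 {n = n} lf =
  Leading-+P-lowerʳ (Leading-+P-lowerʳ (Leading-*P lf lf) (bounded Leading-tP*tP) (ℕ.m<m+n 2 (ℕ.m≤n⇒m≤o+n n z<s))) Degree≤-constP z<s

Leading-xyCircle-const : Leading f 0 a → Leading (xyCircle f) 3 a
Leading-xyCircle-const {f} {a} lf =
  subst (Leading (xyCircle f) 3) (trans (*-identityʳ (a * 1ℚ)) (*-identityʳ a))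
    (Leading-*P (Leading-*P lf Leading-tP) (Leading-circle-const lf))

degree-xyCircle-nonconst : Leading f (suc n) a → ∃[ c ] Leading (xyCircle f) (suc (suc n ℕ.* 3)) c
degree-xyCircle-nonconst {n = zero} lf = _ , Leading-*P (Leading-*P lf Leading-tP) (Leading-circle-linear lf)
degree-xyCircle-nonconst {f} {suc n} {a} lf =
  a * 1ℚ * (a * a) , subst (λ d → Leading (xyCircle f) d (a * 1ℚ * (a * a))) (degree-sum n)
        (Leading-*P (Leading-*P lf Leading-tP) (Leading-circle-≥2 lf))
  where
  degree-sum : ∀ n → (2 ℕ.+ n ℕ.+ 1) ℕ.+ ((2 ℕ.+ n) ℕ.+ (2 ℕ.+ n)) ≡ suc ((2 ℕ.+ n) ℕ.* 3)
  degree-sum = solve-∀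

circle-coeff₀ : ∀ f → coeff (circle f) 0 ≡ coeff f 0 * coeff f 0 - 1ℚ
circle-coeff₀ f = begin
  coeff (circle f) 0                         ≡⟨ coeff-+P (f *P f +P tP *P tP) (negP (constP 1ℚ)) 0 ⟩
  coeff (f *P f +P tP *P tP) 0 - 1ℚ          ≡⟨ cong (_- 1ℚ) (coeff-+P (f *P f) (tP *P tP) 0) ⟩
  coeff (f *P f) 0 + 0ℚ - 1ℚ                 ≡⟨ cong (_- 1ℚ) (+-identityʳ (coeff (f *P f) 0)) ⟩
  coeff (f *P f) 0 - 1ℚ                      ≡⟨ cong (_- 1ℚ) (coeff₀-*P f f) ⟩
  coeff f 0 * coeff f 0 - 1ℚ                 ∎

xyCircle-coeff₀ : ∀ f → coeff (xyCircle f) 0 ≡ 0ℚ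
xyCircle-coeff₀ f = begin
  coeff (xyCircle f) 0                        ≡⟨ coeff₀-*P (f *P tP) (circle f) ⟩
  coeff (f *P tP) 0 * coeff (circle f) 0      ≡⟨ cong (_* coeff (circle f) 0) (*P-tP f 0) ⟩
  0ℚ * coeff (circle f) 0                     ≡⟨ *-zeroˡ (coeff (circle f) 0) ⟩
  0ℚ                                          ∎

xyCircle-coeff₁ : ∀ f → coeff (xyCircle f) 1 ≡ coeff f 0 * (coeff f 0 * coeff f 0 - 1ℚ)
xyCircle-coeff₁ f = begin
  coeff (xyCircle f) 1
    ≡⟨ coeff₁-*P (f *P tP) (circle f) ⟩
  coeff (f *P tP) 0 * coeff (circle f) 1 + coeff (f *P tP) 1 * coeff (circle f) 0
    ≡⟨ cong₂ (λ c d → c * coeff (circle f) 1 + d) (*P-tP f 0) (cong₂ _*_ (*P-tP f 1) (circle-coeff₀ f)) ⟩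
  0ℚ * coeff (circle f) 1 + coeff f 0 * (coeff f 0 * coeff f 0 - 1ℚ)
    ≡⟨ cong (_+ coeff f 0 * (coeff f 0 * coeff f 0 - 1ℚ)) (*-zeroˡ (coeff (circle f) 1)) ⟩
  0ℚ + coeff f 0 * (coeff f 0 * coeff f 0 - 1ℚ)
    ≡⟨ +-identityˡ _ ⟩
  coeff f 0 * (coeff f 0 * coeff f 0 - 1ℚ)
    ∎

cube-coeff₀ : ∀ g → coeff (cube g) 0 ≡ coeff g 0 * coeff g 0 * coeff g 0
cube-coeff₀ g = trans (coeff₀-*P (g *P g) g) (cong (_* coeff g 0) (coeff₀-*P g g))

cube-coeff₁ : ∀ g → coeff g 0 ≡ 0ℚ → coeff (cube g) 1 ≡ 0ℚ
cube-coeff₁ g g₀≡0 = begin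
  coeff (cube g) 1
    ≡⟨ coeff₁-*P (g *P g) g ⟩
  coeff (g *P g) 0 * coeff g 1 + coeff (g *P g) 1 * coeff g 0
    ≡⟨ cong₂ (λ c d → c * coeff g 1 + coeff (g *P g) 1 * d) (trans (coeff₀-*P g g) (cong₂ _*_ g₀≡0 g₀≡0)) g₀≡0 ⟩
  0ℚ * coeff g 1 + coeff (g *P g) 1 * 0ℚ
    ≡⟨ cong₂ _+_ (*-zeroˡ (coeff g 1)) (*-zeroʳ (coeff (g *P g) 1)) ⟩
  0ℚ
    ∎

1+n*3≢m*3 : ∀ n m → suc (n ℕ.* 3) ≢ m ℕ.* 3
1+n*3≢m*3 n m eq with () ← trans (sym ([m+kn]%n≡m%n 1 n 3)) (trans (cong (_% 3) eq) (m*n%n≡0 m 3))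

TrivialSolution : Poly → Poly → Set
TrivialSolution f g = (f ≈P constP 1ℚ × g ≈P tP) ⊎ (f ≈P negP (constP 1ℚ) × g ≈P negP tP)

trivialSolution : f ≈P constP a → g ≈P 0ℚ ∷ a ∷ [] → a ≡ 1ℚ ⊎ a ≡ - 1ℚ → TrivialSolution f g
trivialSolution f≈a g≈at (inj₁ refl) = inj₁ (f≈a , g≈at)
trivialSolution f≈a g≈at (inj₂ refl) = inj₂ (f≈a , g≈at)

constant-case : Leading f 0 a → Leading g m b → xyCircle f ≈P cube g → TrivialSolution f g
constant-case {f = f} {a = a} {g = g} {m = m} lf lg eq
  with Leading-unique (Leading-resp-≈P eq (Leading-xyCircle-const lf)) (Leading-cube lg)
... | 3≡m*3 , a≡b³ with refl ← ℕ.*-cancelʳ-≡ 1 m 3 3≡m*3 =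
  trivialSolution {f = f} {g = g} f≈a g≈at a≡±1
  where
  g₀≡0 : coeff g 0 ≡ 0ℚ
  g₀≡0 = x*x*x≡0⇒x≡0 (trans (sym (cube-coeff₀ g)) (trans (sym (eq 0)) (xyCircle-coeff₀ f)))

  a[a²-1]≡0 : a * (a * a - 1ℚ) ≡ 0ℚ
  a[a²-1]≡0 = begin
    a * (a * a - 1ℚ)                         ≡⟨ cong (λ c → c * (c * c - 1ℚ)) (coeff≡ lf) ⟨
    coeff f 0 * (coeff f 0 * coeff f 0 - 1ℚ) ≡⟨ xyCircle-coeff₁ f ⟨
    coeff (xyCircle f) 1                     ≡⟨ eq 1 ⟩
    coeff (cube g) 1                         ≡⟨ cube-coeff₁ g g₀≡0 ⟩
    0ℚ                                       ∎

  a²-1≡0 : a * a - 1ℚ ≡ 0ℚ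
  a²-1≡0 = fromInj₂ (⊥-elim ∘ nonzero lf) (x*y≡0⇒x≡0∨y≡0 a[a²-1]≡0)

  a≡±1 : a ≡ 1ℚ ⊎ a ≡ - 1ℚ
  a≡±1 = x*x-1≡0⇒x≡1∨x≡-1 a²-1≡0

  f≈a : f ≈P constP a
  f≈a zero    = coeff≡ lf
  f≈a (suc j) = vanishes (bounded lf) (suc j) z<s

  g≈at : g ≈P 0ℚ ∷ a ∷ []
  g≈at zero          = g₀≡0
  g≈at (suc zero)    = trans (coeff≡ lg) (x*x*x≡±1⇒x≡±1 a≡±1 (sym a≡b³))
  g≈at (suc (suc j)) = vanishes (bounded lg) (suc (suc j)) (s≤s z<s)

nonconstant-impossible : Leading f (suc n) a → Leading g m b → ¬ xyCircle f ≈P cube g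
nonconstant-impossible {n = n} {m = m} lf lg eq with degree-xyCircle-nonconst lf
... | _ , lL = 1+n*3≢m*3 (suc n) m (proj₁ (Leading-unique (Leading-resp-≈P eq lL) (Leading-cube lg)))

mainTheorem3 : (f g : Poly) → ¬ (g ≈P []) →
    f *P tP *P (f *P f +P tP *P tP +P negP (constP 1ℚ)) ≈P g *P g *P g →
    (f ≈P constP 1ℚ × g ≈P tP) ⊎ (f ≈P negP (constP 1ℚ) × g ≈P negP tP)
mainTheorem3 f g g≉0 eq with leading? g | leading? f
... | inj₁ g≈0           | _                    = ⊥-elim (g≉0 g≈0)
... | inj₂ (_ , _ , lg)  | inj₁ f≈0             = ⊥-elim (Leading⇒≉P[] (Leading-cube lg) cube≈0)
  where
  cube≈0 : cube g ≈P []
  cube≈0 j = trans (sym (eq j)) (*P-zeroˡ (f *P tP) (circle f) (*P-zeroˡ f tP f≈0) j)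
... | inj₂ (_ , _ , lg)  | inj₂ (zero , _ , lf) = constant-case lf lg eq
... | inj₂ (_ , _ , lg)  | inj₂ (suc _ , _ , lf) = ⊥-elim (nonconstant-impossible lf lg eq)
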